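{- Let $d\ge 2$, $n\ge 0$ and let ${\bf C}$ be a compatible tuple of total orders on $\mathbb{F}^d$. Then the restriction $\gamma^d_{\bf C}$ of the max-tree map $\gamma^d$ to $S^{d-1}_{n,{\bf C}}$ is surjective onto $\mathbb{T}^{2^{d-1}}_n$; i.e. for every $\mathcal{T}\in\mathbb{T}^{2^{d-1}}_n$ there is a $d$-permutation $\boldsymbol\pi$ of size $n$, admissible with respect to ${\bf C}$, with $\gamma^d(\boldsymbol\pi)=\mathcal{T}$.
   Context: A $d$-permutation of size $n$ is a tuple $\boldsymbol{\pi}=(\pi_1,\ldots,\pi_{d-1})$ of permutations of $[n]$; put $\pi_0=\mathrm{id}$. Its points are $(i,\pi_1(i),\ldots,\pi_{d-1}(i))$, $i\in[n]$; $\pi_l(p)$ is the $l$-th coordinate of point $p$. For distinct points $p,q$, ${\bf dir}(p,q)=(\mathrm{sign}(\pi_0(q)-\pi_0(p)),\ldots,\mathrm{sign}(\pi_{d-1}(q)-\pi_{d-1}(p)))$. $\mathbb{F}^d$ is the set of the $2^{d-1}$ directions in $\{+1,-1\}^d$ with last entry $-1$. $\mathbb{T}^{2^{d-1}}_n$ is the set of rooted trees with $n$ internal nodes, each node being a leaf or internal with exactly $2^{d-1}$ children, one labelled by each direction of $\mathbb{F}^d$; $\mathcal{T}_{\bf f}(r)$ denotes the subtree at the child of $r$ labelled ${\bf f}$. Max-tree $\gamma^d(\boldsymbol\pi)$: empty gives a single leaf; otherwise the root corresponds to the point $p_{\max}$ with $\pi_{d-1}(p_{\max})=n$, and the child labelled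 ${\bf f}$ is the max-tree of the sub-$d$-permutation formed by points $p'$ with ${\bf dir}(p_{\max},p')={\bf f}$ (relabelled order-preservingly). Internal nodes correspond to points. A total order is compatible with respect to axis $k$ if no direction with $k$-th entry $+1$ precedes one with $k$-th entry $-1$; ${\bf C}=(C_0,\ldots,C_{d-1})$ is compatible if each $C_k$ is compatible w.r.t. axis $k$. $\boldsymbol\pi$ is admissible w.r.t. ${\bf C}$ (the set of such of size $n$ is $S^{d-1}_{n,{\bf C}}$) if for every internal node $r$ of $\gamma^d(\boldsymbol\pi)$, every $l\in\{0,\ldots,d-1\}$ and all ${\bf f}_1,{\bf f}_2\in\mathbb{F}^d$ with ${\bf f}_1$ before ${\bf f}_2$ in $C_l$, every point of a node of $\mathcal{T}_{{\bf f}_1}(r)$ has smaller $l$-th coordinate than every point of a node of $\mathcal{T}_{{\bf f}_2}(r)$. -}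

module Defs where

open import Level using (0ℓ)
open import Data.Nat as ℕ using (ℕ; zero; suc)
open import Data.Fin using (Fin; zero; suc; fromℕ; _<_; _≤_)
open import Data.Fin.Properties using (<-cmp)
open import Data.Fin.Permutation using (Permutation′; _⟨$⟩ʳ_)
open import Data.Vec using (Vec; []; _∷_)
open import Data.List using (List; []; _∷_; map; _++_)
open import Data.Nat.ListAction using (sum)
open import Data.Sign using (Sign) renaming (- to minus; + to plus)
open import Data.Product using (_×_; Σ; _,_)
open import Data.Unit using (⊤)
open import Relation.Nullary using (¬_)
open import Relation.Binary using (Tri; tri<; tri≈; tri>)
open import Relation.Binary.PropositionalEquality using (_≡_)

-- Throughout, the dimension is d = suc m (so d ≥ 2 iff m ≥ 1).

data Sgn : Set where
  neg zer pos : Sgn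

sgn : ∀ {n} → Fin n → Fin n → Sgn
sgn a b with <-cmp a b
... | tri< _ _ _ = pos
... | tri≈ _ _ _ = zer
... | tri> _ _ _ = neg

-- A d-permutation of size n: (π₁, …, π_{d-1}); π₀ = id is implicit.
DPerm : ℕ → ℕ → Set
DPerm m n = Fin m → Permutation′ n

-- Points are indexed by i ∈ Fin n (i is their 0-th coordinate).
-- coord π l i = π_l(i), with π₀ = id.
coord : ∀ {m n} → DPerm m n → Fin (suc m) → Fin n → Fin n
coord π zero i = i
coord π (suc l) i = π l ⟨$⟩ʳ i

dir : ∀ {m n} → DPerm m n → Fin n → Fin n → Fin (suc m) → Sgn
dir π p q k = sgn (coord π k p) (coord π k q)

-- F^d: directions in {+1,-1}^d with last entry -1; represented by
-- the vector of their first d-1 = m entries.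
FDir : ℕ → Set
FDir m = Vec Sign m

toSgn : Sign → Sgn
toSgn minus = neg
toSgn plus = pos

embed : ∀ {m} → FDir m → Fin (suc m) → Sgn
embed [] zero = neg
embed (s ∷ f) zero = toSgn s
embed (s ∷ f) (suc k) = embed f k

allFDir : ∀ m → List (FDir m)
allFDir zero = [] ∷ []
allFDir (suc m) = map (plus ∷_) (allFDir m) ++ map (minus ∷_) (allFDir m)

-- Trees of T^{2^{d-1}}: each internal node has one child per direction of F^d
data Tree (m : ℕ) : Set where
  leaf : Tree m
  node : (FDir m → Tree m) → Tree m

size : ∀ {m} → Tree m → ℕ
size {m} leaf = zero
size {m} (node ch) = suc (sum (map (λ f → size (ch f)) (allFDir m)))

data _≈T_ {m} : Tree m → Tree m → Set where
  leaf : leaf ≈T leaf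
  node : ∀ {ch ch′} → (∀ f → ch f ≈T ch′ f) → node ch ≈T node ch′

data LTree (m n : ℕ) : Set where
  leaf : LTree m n
  node : Fin n → (FDir m → LTree m n) → LTree m n

forget : ∀ {m n} → LTree m n → Tree m
forget leaf = leaf
forget (node p ch) = node (λ f → forget (ch f))

data _∈T_ {m n} (q : Fin n) : LTree m n → Set where
  here : ∀ {ch} → q ∈T node q ch
  there : ∀ {p ch} f → q ∈T ch f → q ∈T node p ch

-- MaxTree π S t : t is the max-tree γ^d of the sub-d-permutation of π
-- formed by the set of points S (with each internal node labelled by
-- its point). Relabelling order-preservingly does not change
-- directions or relative orders, so it is left implicit.
data MaxTree {m n} (π : DPerm m n) : (Fin n → Set) → LTree m n → Set₁ where
  leaf : ∀ {S} → (∀ i → ¬ S i) → MaxTree π S leaf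
  node : ∀ {S p ch} → S p
       → (∀ q → S q → coord π (fromℕ m) q ≤ coord π (fromℕ m) p)
       → (∀ f → MaxTree π (λ q → S q × (∀ k → dir π p q k ≡ embed f k)) (ch f))
       → MaxTree π S (node p ch)

IsGamma : ∀ {m n} → DPerm m n → LTree m n → Set₁
IsGamma π t = MaxTree π (λ _ → ⊤) t

AdmTree : ∀ {m n} → DPerm m n → (Fin (suc m) → FDir m → FDir m → Set)
        → LTree m n → Set
AdmTree π C leaf = ⊤
AdmTree {m} π C (node p ch) =
  (∀ (l : Fin (suc m)) f₁ f₂ → C l f₁ f₂ →
     ∀ q₁ q₂ → q₁ ∈T ch f₁ → q₂ ∈T ch f₂ →
     coord π l q₁ < coord π l q₂)
  × (∀ f → AdmTree π C (ch f))

Admissible : ∀ {m n} → DPerm m n → (Fin (suc m) → FDir m → FDir m → Set) → Set₁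
Admissible {m} {n} π C = ∀ (t : LTree m n) → IsGamma π t → AdmTree π C t

CompatibleAxis : ∀ {m} → Fin (suc m) → (FDir m → FDir m → Set) → Set
CompatibleAxis k R = ∀ f₁ f₂ → R f₁ f₂ → ¬ (embed f₁ k ≡ pos × embed f₂ k ≡ neg)

-- Along each axis l, order the internal nodes of T recursively: at a node r
-- the subtrees of the children come in the order C_l, and r itself is placed
-- after the children whose direction has l-th entry -1 and before those with
-- l-th entry +1; compatibility of C_l makes this a strict total order. Using
-- the ranks in these d orders as coordinates gives a d-permutation in which a
-- node of the f-subtree of r lies in direction f from r, and r is the highest
-- point of its subtree along the last axis, as every direction of F^d has last
-- entry -1. Hence its max-tree is T, and the separation of the subtrees that
-- admissibility asks for holds by construction. The argument works for every
-- d ≥ 1.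
module Submission where

open import Defs
open import Level using (0ℓ)
open import Data.Nat using (ℕ; zero; suc; _+_; _≤_)
import Data.Nat.Properties as ℕ
open import Data.Fin using (Fin; zero; suc; fromℕ; punchIn; punchOut; _<_)
import Data.Fin as Fin
import Data.Fin.Properties as Fin
open import Data.Fin.Permutation
  using (Permutation; Permutation′; _⟨$⟩ʳ_; id; insert; insert-punchIn; cast-id)
open import Data.Vec using ([]; _∷_)
open import Data.List using (List; map; _++_)
open import Data.List.Properties using (map-++; map-∘)
open import Data.Nat.ListAction using (sum)
open import Data.Nat.ListAction.Properties using (sum-++)
open import Data.Sign using (Sign) renaming (- to minus; + to plus)
open import Data.Product using (Σ; _×_; _,_; proj₁; proj₂)
open import Data.Sum using (_⊎_; inj₁; inj₂)
open import Data.Sum.Function.Propositional using (_⊎-↔_)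
open import Data.Unit using (⊤; tt)
open import Function using (_∘_; _on_; _↔_; Inverse; Injection; mk↔ₛ′)
open import Function.Definitions using (Injective)
open import Function.Properties.Inverse using (↔-sym; ↔-trans; ↔⇒↣)
open import Relation.Nullary using (¬_; Dec; yes; no; contradiction)
open import Relation.Binary using (Rel; Transitive; Irreflexive; Trichotomous; tri<; tri≈; tri>)
open import Relation.Binary.Consequences using (tri⇒irr)
open import Relation.Binary.Structures using (IsStrictTotalOrder)
open import Relation.Binary.PropositionalEquality
  using (_≡_; _≢_; refl; sym; trans; cong; cong₂; subst₂; module ≡-Reasoning)

open Inverse using (to; from; strictlyInverseˡ; strictlyInverseʳ)

trichotomous-on : ∀ {A B : Set} {R : Rel B 0ℓ} (f : A → B) → Injective _≡_ _≡_ f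
                → Trichotomous _≡_ R → Trichotomous _≡_ (R on f)
trichotomous-on f f-inj compare x y with compare (f x) (f y)
... | tri< r ≢ r′ = tri< r (≢ ∘ cong f) r′
... | tri≈ r ≡ r′ = tri≈ r (f-inj ≡) r′
... | tri> r ≢ r′ = tri> r (≢ ∘ cong f) r′

trans∧irr⇒tri : ∀ {A : Set} {R : Rel A 0ℓ} → Transitive R → Irreflexive _≡_ R
             → (∀ x y → x ≡ y ⊎ R x y ⊎ R y x) → Trichotomous _≡_ R
trans∧irr⇒tri tr irr compare x y with compare x y
... | inj₁ x≡y        = tri≈ (irr x≡y) x≡y (irr (sym x≡y))
... | inj₂ (inj₁ xRy) = tri< xRy (λ x≡y → irr x≡y xRy) (λ yRx → irr refl (tr xRy yRx))
... | inj₂ (inj₂ yRx) = tri> (λ xRy → irr refl (tr xRy yRx)) (λ x≡y → irr (sym x≡y) yRx) yRx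

maximum : ∀ n {R : Rel (Fin (suc n)) 0ℓ} → Transitive R → Trichotomous _≡_ R
        → Σ (Fin (suc n)) λ M → ∀ i → i ≢ M → R i M
maximum zero    tr compare = zero , λ { zero 0≢0 → contradiction refl 0≢0 }
maximum (suc n) {R} tr compare
  with maximum n tr (trichotomous-on suc Fin.suc-injective compare)
... | M , isMax with compare zero (suc M)
...   | tri< 0<M _ _ = suc M , λ { zero _ → 0<M ; (suc i) i≢M → isMax i (i≢M ∘ cong suc) }
...   | tri≈ _ () _
...   | tri> _ _ M<0 = zero , below-zero
  where
  below-zero : ∀ i → i ≢ zero → R i zero
  below-zero zero    0≢0 = contradiction refl 0≢0
  below-zero (suc i) _ with i Fin.≟ M
  ... | yes refl = M<0
  ... | no  i≢M  = tr (isMax i i≢M) M<0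

insert-pivot : ∀ {m n} i j (σ : Permutation m n) → insert i j σ ⟨$⟩ʳ i ≡ j
insert-pivot i j σ with i Fin.≟ i
... | yes _   = refl
... | no  i≢i = contradiction refl i≢i

punchIn-mono-< : ∀ {n} (i : Fin (suc n)) {j k : Fin n} → j < k → punchIn i j < punchIn i k
punchIn-mono-< i {j} {k} j<k = ℕ.≰⇒> (ℕ.<⇒≱ j<k ∘ Fin.punchIn-cancel-≤ i k j)

punchIn-fromℕ-< : ∀ {n} (j : Fin n) → punchIn (fromℕ n) j < fromℕ n
punchIn-fromℕ-< j = Fin.≤∧≢⇒< (Fin.≤fromℕ _) (Fin.punchInᵢ≢i _ j)

-- Selection sort: a maximum goes to the last position.
sort : ∀ n {R : Rel (Fin n) 0ℓ} → Transitive R → Trichotomous _≡_ R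
     → Σ (Permutation′ n) λ σ → ∀ {i j} → R i j → σ ⟨$⟩ʳ i < σ ⟨$⟩ʳ j
sort zero    tr compare = id , λ { {()} }
sort (suc n) {R} tr compare with maximum n tr compare
... | M , isMax with sort n tr (trichotomous-on (punchIn M) (Fin.punchIn-injective M _ _) compare)
...   | σ′ , σ′-mono = σ , σ-mono
  where
  σ : Permutation′ (suc n)
  σ = insert M (fromℕ n) σ′

  σ-off-M : ∀ {i} (M≢i : M ≢ i) → σ ⟨$⟩ʳ i ≡ punchIn (fromℕ n) (σ′ ⟨$⟩ʳ punchOut M≢i)
  σ-off-M M≢i = trans (cong (σ ⟨$⟩ʳ_) (sym (Fin.punchIn-punchOut M≢i)))
                      (insert-punchIn M (fromℕ n) σ′ (punchOut M≢i))

  nothing-above-M : ∀ j → ¬ R M j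
  nothing-above-M j M<j with j Fin.≟ M
  ... | yes refl = tri⇒irr compare refl M<j
  ... | no  j≢M  = tri⇒irr compare refl (tr M<j (isMax j j≢M))

  σ-mono : ∀ {i j} → R i j → σ ⟨$⟩ʳ i < σ ⟨$⟩ʳ j
  σ-mono {i} {j} = by-cases (M Fin.≟ i) (M Fin.≟ j)
    where
    by-cases : Dec (M ≡ i) → Dec (M ≡ j) → R i j → σ ⟨$⟩ʳ i < σ ⟨$⟩ʳ j
    by-cases (yes refl) _          i<j = contradiction i<j (nothing-above-M j)
    by-cases (no M≢i)   (yes refl) _   =
      subst₂ _<_ (sym (σ-off-M M≢i)) (sym (insert-pivot M (fromℕ n) σ′)) (punchIn-fromℕ-< _)
    by-cases (no M≢i)   (no M≢j)   i<j =
      subst₂ _<_ (sym (σ-off-M M≢i)) (sym (σ-off-M M≢j))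
        (punchIn-mono-< (fromℕ n) (σ′-mono
          (subst₂ R (sym (Fin.punchIn-punchOut M≢i)) (sym (Fin.punchIn-punchOut M≢j)) i<j)))

rank : ∀ {A : Set} {n} {R : Rel A 0ℓ} → A ↔ Fin n → Transitive R → Trichotomous _≡_ R
     → Σ (A ↔ Fin n) λ ρ → ∀ {x y} → R x y → to ρ x < to ρ y
rank {n = n} {R} e tr compare
  with sort n {R on from e} tr (trichotomous-on (from e) (Injection.injective (↔⇒↣ (↔-sym e))) compare)
... | σ , σ-mono = ↔-trans e σ , λ {x} {y} xRy →
  σ-mono (subst₂ R (sym (strictlyInverseʳ e x)) (sym (strictlyInverseʳ e y)) xRy)

sgn-self : ∀ {n} (a : Fin n) → sgn a a ≡ zer
sgn-self a with Fin.<-cmp a a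
... | tri< a<a _ _ = contradiction a<a (Fin.<-irrefl refl)
... | tri≈ _ _ _   = refl
... | tri> _ _ a>a = contradiction a>a (Fin.<-irrefl refl)

sgn-< : ∀ {n} {a b : Fin n} → a < b → sgn a b ≡ pos
sgn-< {a = a} {b} a<b with Fin.<-cmp a b
... | tri< _ _ _   = refl
... | tri≈ _ a≡b _ = contradiction a<b (Fin.<-irrefl a≡b)
... | tri> _ _ b<a = contradiction b<a (Fin.<-asym a<b)

sgn-> : ∀ {n} {a b : Fin n} → b < a → sgn a b ≡ neg
sgn-> {a = a} {b} b<a with Fin.<-cmp a b
... | tri< a<b _ _ = contradiction b<a (Fin.<-asym a<b)
... | tri≈ _ a≡b _ = contradiction b<a (Fin.<-irrefl (sym a≡b))
... | tri> _ _ _   = refl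

neg≢pos : ∀ {s} → s ≡ neg → s ≢ pos
neg≢pos refl ()

embed-neg⊎pos : ∀ {m} (f : FDir m) l → embed f l ≡ neg ⊎ embed f l ≡ pos
embed-neg⊎pos []          zero    = inj₁ refl
embed-neg⊎pos (minus ∷ f) zero    = inj₁ refl
embed-neg⊎pos (plus ∷ f)  zero    = inj₂ refl
embed-neg⊎pos (s ∷ f)     (suc l) = embed-neg⊎pos f l

embed-fromℕ : ∀ {m} (f : FDir m) → embed f (fromℕ m) ≡ neg
embed-fromℕ []      = refl
embed-fromℕ (s ∷ f) = embed-fromℕ f

toSgn-injective : ∀ {s t} → toSgn s ≡ toSgn t → s ≡ t
toSgn-injective {minus} {minus} _ = refl
toSgn-injective {plus}  {plus}  _ = refl

embed-injective : ∀ {m} {f g : FDir m} → (∀ l → embed f l ≡ embed g l) → f ≡ g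
embed-injective {f = []}    {[]}    _     = refl
embed-injective {f = s ∷ f} {t ∷ g} f≗g =
  cong₂ _∷_ (toSgn-injective (f≗g zero)) (embed-injective (f≗g ∘ suc))

sum-allFDir-suc : ∀ k (s : FDir (suc k) → ℕ)
  → sum (map s (allFDir (suc k)))
  ≡ sum (map (s ∘ (plus ∷_)) (allFDir k)) + sum (map (s ∘ (minus ∷_)) (allFDir k))
sum-allFDir-suc k s = begin
  sum (map s (map (plus ∷_) fs ++ map (minus ∷_) fs))
    ≡⟨ cong sum (map-++ s (map (plus ∷_) fs) (map (minus ∷_) fs)) ⟩
  sum (map s (map (plus ∷_) fs) ++ map s (map (minus ∷_) fs))
    ≡⟨ sum-++ (map s (map (plus ∷_) fs)) (map s (map (minus ∷_) fs)) ⟩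
  sum (map s (map (plus ∷_) fs)) + sum (map s (map (minus ∷_) fs))
    ≡⟨ cong₂ _+_ (cong sum (sym (map-∘ fs))) (cong sum (sym (map-∘ fs))) ⟩
  sum (map (s ∘ (plus ∷_)) fs) + sum (map (s ∘ (minus ∷_)) fs) ∎
  where
  open ≡-Reasoning
  fs : List (FDir k)
  fs = allFDir k

Σ-FDir↔ : ∀ k {A : FDir k → Set} (s : FDir k → ℕ) → (∀ f → A f ↔ Fin (s f))
        → Σ (FDir k) A ↔ Fin (sum (map s (allFDir k)))
Σ-FDir↔ zero {A} s e = ↔-trans Σ-[]↔ (↔-trans (e []) (cast-id (sym (ℕ.+-identityʳ (s [])))))
  where
  Σ-[]↔ : Σ (FDir zero) A ↔ A []
  Σ-[]↔ = mk↔ₛ′ (λ { ([] , a) → a }) ([] ,_) (λ _ → refl) (λ { ([] , a) → refl })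
Σ-FDir↔ (suc k) {A} s e =
  ↔-trans Σ-∷↔⊎
    (↔-trans (Σ-FDir↔ k _ (e ∘ (plus ∷_)) ⊎-↔ Σ-FDir↔ k _ (e ∘ (minus ∷_)))
      (↔-trans (↔-sym Fin.+↔⊎) (cast-id (sym (sum-allFDir-suc k s)))))
  where
  Σ-∷↔⊎ : Σ (FDir (suc k)) A ↔ (Σ (FDir k) (A ∘ (plus ∷_)) ⊎ Σ (FDir k) (A ∘ (minus ∷_)))
  Σ-∷↔⊎ = mk↔ₛ′
    (λ { (plus ∷ f , a) → inj₁ (f , a) ; (minus ∷ f , a) → inj₂ (f , a) })
    (λ { (inj₁ (f , a)) → plus ∷ f , a ; (inj₂ (f , a)) → minus ∷ f , a })
    (λ { (inj₁ _) → refl ; (inj₂ _) → refl })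
    (λ { (plus ∷ f , a) → refl ; (minus ∷ f , a) → refl })

data Node {m} : Tree m → Set where
  root  : ∀ {ch} → Node (node ch)
  child : ∀ {ch} f → Node (ch f) → Node (node ch)

leaf-has-no-node : ∀ {m} → ¬ Node {m} leaf
leaf-has-no-node ()

nodes↔ : ∀ {m} (T : Tree m) → Node T ↔ Fin (size T)
nodes↔ leaf      = mk↔ₛ′ (λ ()) (λ ()) (λ ()) (λ ())
nodes↔ (node ch) =
  ↔-trans node↔⊎ (↔-trans (↔-sym Fin.1↔⊤ ⊎-↔ Σ-FDir↔ _ _ (nodes↔ ∘ ch)) (↔-sym Fin.+↔⊎))
  where
  node↔⊎ : Node (node ch) ↔ (⊤ ⊎ Σ _ (Node ∘ ch))
  node↔⊎ = mk↔ₛ′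
    (λ { root → inj₁ tt ; (child f P) → inj₂ (f , P) })
    (λ { (inj₁ _) → root ; (inj₂ (f , P)) → child f P })
    (λ { (inj₁ _) → refl ; (inj₂ _) → refl })
    (λ { root → refl ; (child f P) → refl })

label : ∀ {m n} (T : Tree m) → (Node T → Fin n) → LTree m n
label leaf      ι = leaf
label (node ch) ι = node (ι root) (λ f → label (ch f) (ι ∘ child f))

forget-label : ∀ {m n} (T : Tree m) (ι : Node T → Fin n) → forget (label T ι) ≈T T
forget-label leaf      ι = leaf
forget-label (node ch) ι = node (λ f → forget-label (ch f) (ι ∘ child f))

maxTree-⊆ : ∀ {m n} {π : DPerm m n} {S t q} → MaxTree π S t → q ∈T t → S q
maxTree-⊆ (node p∈S _ _)  here          = p∈S
maxTree-⊆ (node _ _ sub) (there f q∈t) = proj₁ (maxTree-⊆ (sub f) q∈t)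

dpermOf : ∀ {A : Set} {m n} → (Fin (suc m) → A ↔ Fin n) → DPerm m n
dpermOf ρ l = ↔-trans (↔-sym (ρ zero)) (ρ (suc l))

coord-dpermOf : ∀ {A : Set} {m n} (ρ : Fin (suc m) → A ↔ Fin n) l x
              → coord (dpermOf ρ) l (to (ρ zero) x) ≡ to (ρ l) x
coord-dpermOf ρ zero    x = refl
coord-dpermOf ρ (suc l) x = cong (to (ρ (suc l))) (strictlyInverseʳ (ρ zero) x)

module _ {m : ℕ} (C : Fin (suc m) → FDir m → FDir m → Set) where

  data _⊏⟨_⟩_ : ∀ {T} → Node T → Fin (suc m) → Node T → Set where
    child⊏root  : ∀ {ch f l} {P : Node (ch f)} → embed f l ≡ neg → child {ch = ch} f P ⊏⟨ l ⟩ root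
    root⊏child  : ∀ {ch f l} {P : Node (ch f)} → embed f l ≡ pos → root ⊏⟨ l ⟩ child {ch = ch} f P
    child⊏child : ∀ {ch f g l} {P : Node (ch f)} {Q : Node (ch g)} → C l f g
                → child {ch = ch} f P ⊏⟨ l ⟩ child g Q
    within      : ∀ {ch f l} {P Q : Node (ch f)} → P ⊏⟨ l ⟩ Q
                → child {ch = ch} f P ⊏⟨ l ⟩ child f Q

  module _ (sto : ∀ k → IsStrictTotalOrder _≡_ (C k)) (comp : ∀ k → CompatibleAxis k (C k))
           (l : Fin (suc m)) where

    open IsStrictTotalOrder (sto l) using ()
      renaming (trans to C-trans; irrefl to C-irrefl; compare to C-compare)

    pos-upward : ∀ {f g} → C l f g → embed f l ≡ pos → embed g l ≡ pos
    pos-upward {f} {g} f<g f⁺ with embed-neg⊎pos g l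
    ... | inj₁ g⁻ = contradiction (f⁺ , g⁻) (comp l f g f<g)
    ... | inj₂ g⁺ = g⁺

    neg-downward : ∀ {f g} → C l f g → embed g l ≡ neg → embed f l ≡ neg
    neg-downward {f} {g} f<g g⁻ with embed-neg⊎pos f l
    ... | inj₁ f⁻ = f⁻
    ... | inj₂ f⁺ = contradiction (f⁺ , g⁻) (comp l f g f<g)

    ⊏-irrefl : ∀ {T} → Irreflexive _≡_ (λ (P Q : Node T) → P ⊏⟨ l ⟩ Q)
    ⊏-irrefl refl (child⊏child f<f) = C-irrefl refl f<f
    ⊏-irrefl refl (within P<P)      = ⊏-irrefl refl P<P

    ⊏-trans : ∀ {T} → Transitive (λ (P Q : Node T) → P ⊏⟨ l ⟩ Q)
    ⊏-trans (child⊏root {f = f} f⁻) (root⊏child {f = g} g⁺) with C-compare f g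
    ... | tri< f<g _ _  = child⊏child f<g
    ... | tri≈ _ refl _ = contradiction g⁺ (neg≢pos f⁻)
    ... | tri> _ _ g<f  = contradiction (g⁺ , f⁻) (comp l g f g<f)
    ⊏-trans (root⊏child f⁺)   (child⊏root f⁻)    = contradiction f⁺ (neg≢pos f⁻)
    ⊏-trans (root⊏child f⁺)   (child⊏child f<g)  = root⊏child (pos-upward f<g f⁺)
    ⊏-trans (root⊏child f⁺)   (within _)         = root⊏child f⁺
    ⊏-trans (child⊏child f<g) (child⊏root g⁻)    = child⊏root (neg-downward f<g g⁻)
    ⊏-trans (child⊏child f<g) (child⊏child g<h)  = child⊏child (C-trans f<g g<h)
    ⊏-trans (child⊏child f<g) (within _)         = child⊏child f<g
    ⊏-trans (within _)        (child⊏root f⁻)    = child⊏root f⁻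
    ⊏-trans (within _)        (child⊏child f<g)  = child⊏child f<g
    ⊏-trans (within P<Q)      (within Q<R)       = within (⊏-trans P<Q Q<R)

    ⊏-compare : ∀ {T} (P Q : Node T) → P ≡ Q ⊎ P ⊏⟨ l ⟩ Q ⊎ Q ⊏⟨ l ⟩ P
    ⊏-compare root root = inj₁ refl
    ⊏-compare root (child f _) with embed-neg⊎pos f l
    ... | inj₁ f⁻ = inj₂ (inj₂ (child⊏root f⁻))
    ... | inj₂ f⁺ = inj₂ (inj₁ (root⊏child f⁺))
    ⊏-compare (child f _) root with embed-neg⊎pos f l
    ... | inj₁ f⁻ = inj₂ (inj₁ (child⊏root f⁻))
    ... | inj₂ f⁺ = inj₂ (inj₂ (root⊏child f⁺))
    ⊏-compare (child f P) (child g Q) with C-compare f g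
    ... | tri< f<g _ _  = inj₂ (inj₁ (child⊏child f<g))
    ... | tri> _ _ g<f  = inj₂ (inj₂ (child⊏child g<f))
    ... | tri≈ _ refl _ with ⊏-compare P Q
    ...   | inj₁ refl       = inj₁ refl
    ...   | inj₂ (inj₁ P<Q) = inj₂ (inj₁ (within P<Q))
    ...   | inj₂ (inj₂ Q<P) = inj₂ (inj₂ (within Q<P))

    ⊏-trichotomous : ∀ {T} → Trichotomous _≡_ (λ (P Q : Node T) → P ⊏⟨ l ⟩ Q)
    ⊏-trichotomous = trans∧irr⇒tri ⊏-trans ⊏-irrefl ⊏-compare

  module _ {n} (π : DPerm m n) where

    Monotone : (T : Tree m) → (Node T → Fin n) → Set
    Monotone T ι = ∀ l {P Q} → P ⊏⟨ l ⟩ Q → coord π l (ι P) < coord π l (ι Q)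

    Enumerates : (T : Tree m) → (Node T → Fin n) → (Fin n → Set) → Set
    Enumerates T ι S = (∀ P → S (ι P)) × (∀ q → S q → Σ (Node T) λ P → ι P ≡ q)

    Sector : (Fin n → Set) → Fin n → FDir m → Fin n → Set
    Sector S p f q = S q × (∀ k → dir π p q k ≡ embed f k)

    module _ {ch : FDir m → Tree m} {ι : Node (node ch) → Fin n} (mono : Monotone (node ch) ι) where

      child-below-root : ∀ f (P : Node (ch f))
                       → coord π (fromℕ m) (ι (child f P)) < coord π (fromℕ m) (ι root)
      child-below-root f P = mono (fromℕ m) (child⊏root (embed-fromℕ f))

      dir-child : ∀ f (P : Node (ch f)) k → dir π (ι root) (ι (child f P)) k ≡ embed f k
      dir-child f P k with embed-neg⊎pos f k
      ... | inj₁ f⁻ = trans (sgn-> (mono k (child⊏root f⁻))) (sym f⁻)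
      ... | inj₂ f⁺ = trans (sgn-< (mono k (root⊏child f⁺))) (sym f⁺)

      monotone-child : ∀ f → Monotone (ch f) (ι ∘ child f)
      monotone-child f l P<Q = mono l (within P<Q)

      enumerates-child : ∀ {S} → Enumerates (node ch) ι S
                       → ∀ f → Enumerates (ch f) (ι ∘ child f) (Sector S (ι root) f)
      enumerates-child {S} (into , onto) f = (λ P → into (child f P) , dir-child f P) , onto-sector
        where
        onto-sector : ∀ q → Sector S (ι root) f q → Σ (Node (ch f)) λ P → ι (child f P) ≡ q
        onto-sector q (q∈S , q-dir) with onto q q∈S
        ... | root , refl =
          contradiction (trans (sym (sgn-self _)) (trans (q-dir (fromℕ m)) (embed-fromℕ f))) λ ()
        ... | child g P , refl
          with embed-injective {f = g} {f} (λ k → trans (sym (dir-child g P k)) (q-dir k))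
        ...   | refl = P , refl

    label-maxTree : ∀ T {ι S} → Monotone T ι → Enumerates T ι S → MaxTree π S (label T ι)
    label-maxTree leaf _ (_ , onto) = leaf λ q q∈S → leaf-has-no-node (proj₁ (onto q q∈S))
    label-maxTree (node ch) {ι} {S} mono enum@(into , onto) =
      node (into root) root-highest
        (λ f → label-maxTree (ch f) (monotone-child mono f) (enumerates-child mono enum f))
      where
      root-highest : ∀ q → S q → coord π (fromℕ m) q Fin.≤ coord π (fromℕ m) (ι root)
      root-highest q q∈S with onto q q∈S
      ... | root , refl      = Fin.≤-refl
      ... | child f P , refl = ℕ.<⇒≤ (child-below-root mono f P)

    maxTree-admissible : ∀ T {ι S t} → Monotone T ι → Enumerates T ι S → MaxTree π S t → AdmTree π C t
    maxTree-admissible _    _ _          (leaf _)       = tt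
    maxTree-admissible leaf _ (_ , onto) (node p∈S _ _) = contradiction (proj₁ (onto _ p∈S)) leaf-has-no-node
    maxTree-admissible (node ch) {ι} mono enum@(into , onto)
                       (node {p = p} {ch = sub} p∈S p-highest sub-max) with onto p p∈S
    ... | child g P , refl =
      contradiction (p-highest (ι root) (into root)) (ℕ.<⇒≱ (child-below-root mono g P))
    ... | root , refl =
      separated , λ f → maxTree-admissible (ch f) (monotone-child mono f)
                                           (enumerates-child mono enum f) (sub-max f)
      where
      separated : ∀ l f₁ f₂ → C l f₁ f₂ → ∀ q₁ q₂ → q₁ ∈T sub f₁ → q₂ ∈T sub f₂
                → coord π l q₁ < coord π l q₂
      separated l f₁ f₂ f₁<f₂ q₁ q₂ q₁∈t q₂∈t
        with proj₂ (enumerates-child mono enum f₁) q₁ (maxTree-⊆ (sub-max f₁) q₁∈t)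
           | proj₂ (enumerates-child mono enum f₂) q₂ (maxTree-⊆ (sub-max f₂) q₂∈t)
      ... | P₁ , refl | P₂ , refl = mono l (child⊏child f₁<f₂)

  module _ (sto : ∀ k → IsStrictTotalOrder _≡_ (C k)) (comp : ∀ k → CompatibleAxis k (C k)) where

    realise : ∀ T → Σ (DPerm m (size T)) λ π → Admissible π C
                      × Σ (LTree m (size T)) λ t → IsGamma π t × forget t ≈T T
    realise T = π , (λ t γ → maxTree-admissible π T mono enum γ)
                  , label T ι , label-maxTree π T mono enum , forget-label T ι
      where
      ranking : ∀ l → Σ (Node T ↔ Fin (size T)) λ ρ → ∀ {P Q} → P ⊏⟨ l ⟩ Q → to ρ P < to ρ Q
      ranking l = rank (nodes↔ T) (⊏-trans sto comp l) (⊏-trichotomous sto comp l)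

      ρ : Fin (suc m) → Node T ↔ Fin (size T)
      ρ = proj₁ ∘ ranking

      π : DPerm m (size T)
      π = dpermOf ρ

      ι : Node T → Fin (size T)
      ι = to (ρ zero)

      mono : Monotone π T ι
      mono l {P} {Q} P<Q =
        subst₂ _<_ (sym (coord-dpermOf ρ l P)) (sym (coord-dpermOf ρ l Q)) (proj₂ (ranking l) P<Q)

      enum : Enumerates π T ι (λ _ → ⊤)
      enum = (λ _ → tt) , λ q _ → from (ρ zero) q , strictlyInverseˡ (ρ zero) q

lemma1 : (m n : ℕ) → 2 ≤ suc m
         → (C : Fin (suc m) → FDir m → FDir m → Set)
         → (∀ k → IsStrictTotalOrder _≡_ (C k))
         → (∀ k → CompatibleAxis k (C k))
         → (T : Tree m) → size T ≡ n
         → Σ (DPerm m n) (λ π → Admissible π C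
             × Σ (LTree m n) (λ t → IsGamma π t × forget t ≈T T))
lemma1 m _ _ C sto comp T refl = realise C sto comp T
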